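{- For every bipartite graph $G$ and every connected graph $H$, the lexicographic product $G\cdot H$ is a minor of $G\,\square\,H\,\square\,H$.
   Context: All graphs are finite, simple and undirected. The lexicographic product $G\cdot H$ has vertex set $V(G)\times V(H)$, with $(v,x)$ adjacent to $(w,y)$ iff $vw\in E(G)$, or $v=w$ and $xy\in E(H)$. The Cartesian product $G\,\square\,H$ has vertex set $V(G)\times V(H)$, with $(v,x)(w,y)$ an edge iff ($vw\in E(G)$ and $x=y$) or ($v=w$ and $xy\in E(H)$). -}

module Defs where

open import Data.Nat using (ℕ)
open import Data.Fin using (Fin)
open import Data.Bool using (Bool)
open import Data.Product using (Σ; ∃; _×_; _,_)
open import Data.Sum using (_⊎_)
open import Data.Empty using (⊥)
open import Relation.Nullary using (¬_)
open import Relation.Binary.PropositionalEquality using (_≡_; _≢_)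

record Graph (V : Set) : Set₁ where
  field
    Adj    : V → V → Set
    sym    : ∀ {u v} → Adj u v → Adj v u
    irrefl : ∀ {u} → ¬ Adj u u
open Graph public

data WalkIn {V : Set} (G : Graph V) (P : V → Set) : V → V → Set where
  here : ∀ {u} → P u → WalkIn G P u u
  step : ∀ {u v w} → P u → Adj G u v → WalkIn G P v w → WalkIn G P u w

Connected : ∀ {V} → Graph V → Set
Connected {V} G = V × (∀ (u v : V) → WalkIn G (λ _ → V) u v)

Bipartite : ∀ {V} → Graph V → Set
Bipartite {V} G = Σ (V → Bool) λ c → ∀ u v → Adj G u v → c u ≢ c v

lex : ∀ {V W} → Graph V → Graph W → Graph (V × W)
lex G H = record
  { Adj = λ { (v , x) (w , y) → Adj G v w ⊎ (v ≡ w × Adj H x y) }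
  ; sym = λ { (Data.Sum.inj₁ a) → Data.Sum.inj₁ (sym G a)
            ; (Data.Sum.inj₂ (Relation.Binary.PropositionalEquality.refl , b)) →
                 Data.Sum.inj₂ (Relation.Binary.PropositionalEquality.refl , sym H b) }
  ; irrefl = λ { (Data.Sum.inj₁ a) → irrefl G a ; (Data.Sum.inj₂ (_ , b)) → irrefl H b }
  }

cart : ∀ {V W} → Graph V → Graph W → Graph (V × W)
cart G H = record
  { Adj = λ { (v , x) (w , y) → (Adj G v w × x ≡ y) ⊎ (v ≡ w × Adj H x y) }
  ; sym = λ { (Data.Sum.inj₁ (a , Relation.Binary.PropositionalEquality.refl)) →
                 Data.Sum.inj₁ (sym G a , Relation.Binary.PropositionalEquality.refl)
            ; (Data.Sum.inj₂ (Relation.Binary.PropositionalEquality.refl , b)) →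
                 Data.Sum.inj₂ (Relation.Binary.PropositionalEquality.refl , sym H b) }
  ; irrefl = λ { (Data.Sum.inj₁ (a , _)) → irrefl G a ; (Data.Sum.inj₂ (_ , b)) → irrefl H b }
  }

record Minor {W V : Set} (H : Graph W) (G : Graph V) : Set₁ where
  field
    Branch    : W → V → Set
    nonempty  : ∀ x → ∃ λ u → Branch x u
    disjoint  : ∀ x y u → Branch x u → Branch y u → x ≡ y
    connected : ∀ x u u' → Branch x u → Branch x u' → WalkIn G (Branch x) u u'
    edges     : ∀ x y → Adj H x y → ∃ λ u → ∃ λ u' → Branch x u × Branch y u' × Adj G u u'

module Submission where

-- Properly 2-colour G by c.  The vertex (v , x) of G · H becomes the
-- branch set Fibre (c v) v x: the copy of H inside {v} × H × H obtained by fixing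
-- the coordinate selected by the colour c v to be x (the second coordinate if
-- c v is false, the third if c v is true) and letting the other one vary.
--   * Each fibre is an isomorphic copy of H, hence connected when H is, and
--     nonempty as soon as H has a vertex.
--   * Fibres are disjoint: a vertex ((v , a) , b) determines v, hence c v, and
--     then the selected coordinate determines x.
--   * An H-edge xy inside one G-vertex v is realised inside {v} × H × H by
--     moving the selected coordinate along xy.
--   * A G-edge vw has c v ≢ c w, so the fibres of (v , x) and (w , y) select
--     different coordinates; the vertices ((v , x) , y) and ((w , x) , y)
--     (or their mirror images) then lie in them and are joined by a G-edge.

open import Defs
open import Data.Nat using (ℕ)
open import Data.Fin using (Fin)
open import Data.Bool using (Bool; true; false)
open import Data.Product using (∃; _×_; _,_)
open import Data.Sum using (inj₁; inj₂)
open import Data.Empty using (⊥-elim)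
open import Relation.Binary.PropositionalEquality using (_≡_; _≢_; refl; trans; cong) renaming (sym to ≡-sym)

mapWalk : ∀ {A B : Set} {G : Graph A} {K : Graph B} {P : A → Set} {Q : B → Set}
          (f : A → B) → (∀ {a a'} → Adj G a a' → Adj K (f a) (f a')) →
          (∀ {a} → P a → Q (f a)) →
          ∀ {u v} → WalkIn G P u v → WalkIn K Q (f u) (f v)
mapWalk f hom pres (here p)       = here (pres p)
mapWalk f hom pres (step p e walk) = step (pres p) (hom e) (mapWalk f hom pres walk)

pick : Bool → ∀ {W : Set} → W × W → W
pick false (a , b) = a
pick true  (a , b) = b

module Fibres {V W : Set} (G : Graph V) (H : Graph W) where

  K : Graph ((V × W) × W)
  K = cart (cart G H) H

  Fibre : Bool → V → W → (V × W) × W → Set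
  Fibre β v x ((v' , a) , b) = v' ≡ v × pick β (a , b) ≡ x

  fibre-nonempty : ∀ β v x → W → ∃ (Fibre β v x)
  fibre-nonempty false v x y = ((v , x) , y) , refl , refl
  fibre-nonempty true  v x y = ((v , y) , x) , refl , refl

  -- Walks of H, run in the free coordinate, connect any two fibre vertices.
  fibre-connected : (∀ y y' → WalkIn H (λ _ → W) y y') →
                    ∀ β v x u u' → Fibre β v x u → Fibre β v x u' →
                    WalkIn K (Fibre β v x) u u'
  fibre-connected walks false v x ((.v , .x) , b) ((.v , .x) , b') (refl , refl) (refl , refl) =
    mapWalk (λ y → ((v , x) , y)) (λ e → inj₂ (refl , e)) (λ _ → refl , refl) (walks b b')
  fibre-connected walks true v x ((.v , a) , .x) ((.v , a') , .x) (refl , refl) (refl , refl) =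
    mapWalk (λ y → ((v , y) , x)) (λ e → inj₁ (inj₂ (refl , e) , refl)) (λ _ → refl , refl)
            (walks a a')

  fibre-edge-H : ∀ β v {x y} → W → Adj H x y →
                 ∃ λ u → ∃ λ u' → Fibre β v x u × Fibre β v y u' × Adj K u u'
  fibre-edge-H false v {x} {y} z e =
    ((v , x) , z) , ((v , y) , z) , (refl , refl) , (refl , refl) , inj₁ (inj₂ (refl , e) , refl)
  fibre-edge-H true  v {x} {y} z e =
    ((v , z) , x) , ((v , z) , y) , (refl , refl) , (refl , refl) , inj₂ (refl , e)

  fibre-edge-G : ∀ β γ → β ≢ γ → ∀ {v w} x y → Adj G v w →
                 ∃ λ u → ∃ λ u' → Fibre β v x u × Fibre γ w y u' × Adj K u u'
  fibre-edge-G false false β≢γ x y e = ⊥-elim (β≢γ refl)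
  fibre-edge-G true  true  β≢γ x y e = ⊥-elim (β≢γ refl)
  fibre-edge-G false true  _ {v} {w} x y e =
    ((v , x) , y) , ((w , x) , y) , (refl , refl) , (refl , refl) , inj₁ (inj₁ (e , refl) , refl)
  fibre-edge-G true  false _ {v} {w} x y e =
    ((v , y) , x) , ((w , y) , x) , (refl , refl) , (refl , refl) , inj₁ (inj₁ (e , refl) , refl)

lex-minor-of-cart-cube : ∀ {V W : Set} (G : Graph V) (H : Graph W) →
                         Bipartite G → Connected H → Minor (lex G H) (cart (cart G H) H)
lex-minor-of-cart-cube G H (c , proper) (y₀ , walks) = record
  { Branch    = λ { (v , x) → Fibre (c v) v x }
  ; nonempty  = λ { (v , x) → fibre-nonempty (c v) v x y₀ }
  ; disjoint  = λ { (v , x) (.v , y) ((.v , a) , b) (refl , s) (refl , t) →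
                    cong (v ,_) (trans (≡-sym s) t) }
  ; connected = λ { (v , x) → fibre-connected walks (c v) v x }
  ; edges     = λ { (v , x) (w , y) (inj₁ e)          → fibre-edge-G (c v) (c w) (proper v w e) x y e
                  ; (v , x) (.v , y) (inj₂ (refl , e)) → fibre-edge-H (c v) v y₀ e }
  }
  where open Fibres G H

mainTheorem15 : (n m : ℕ) (G : Graph (Fin n)) (H : Graph (Fin m)) →
    Bipartite G → Connected H → Minor (lex G H) (cart (cart G H) H)
mainTheorem15 n m = lex-minor-of-cart-cube
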